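{- Let $N$ be a homogeneous network with asymmetric inputs represented by $\sigma_1,\dots,\sigma_k$ and $\tilde{N}$ its fundamental network. Then $\mathrm{depth}_i(N)=\mathrm{depth}_i(\tilde{N})$ for every $i=1,\dots,k$.
   Context: A homogeneous network with asymmetric inputs has a finite cell set $C$, one cell type, $k$ edge types, each cell receiving exactly one edge of each type; it is represented by $\sigma_1,\dots,\sigma_k:C\to C$ (type-$i$ edge into $c$ comes from $\sigma_i(c)$). The fundamental network $\tilde{N}$ has as cells the semigroup $\tilde{C}$ of maps $C\to C$ generated under composition by $Id_C,\sigma_1,\dots,\sigma_k$, represented by $\tilde{\sigma}_i(\gamma)=\sigma_i\circ\gamma$. For a network $M$ of this kind, $M_i$ is the network with the same cells and only the edges of type $i$. Each connected component (maximal set of cells pairwise joined by undirected paths) $C_i^j$ of $M_i$ contains a unique source (a strongly connected component receiving no edge from outside it), called the ring $R_i^j$. With $|(r,c)|$ equal to $0$ if $r=c$ and otherwise the length of a shortest directed path in $M_i$ from $r$ to $c$, $\mathrm{depth}_i^j(M)=\max_{c\in C_i^j}\min_{r\in R_i^j}|(r,c)|$ and $\mathrm{depth}_i(M)=\max_j\mathrm{depth}_i^j(M)$. -}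

module Defs where

open import Data.Nat using (ℕ; zero; suc; _≤_)
open import Data.Fin using (Fin)
open import Data.Vec using (Vec; map; allFin)
open import Data.Product using (Σ; ∃; _×_; _,_)
open import Data.Unit using (⊤)
open import Relation.Binary.PropositionalEquality using (_≡_)

-- A "single-edge-type" network M_i : a carrier X, a predicate selecting
-- the cells, and a map f such that the (unique) edge into a cell c
-- comes from f c.
record FunNet : Set₁ where
  field
    X      : Set
    IsCell : X → Set
    f      : X → X

module _ (M : FunNet) where
  open FunNet M

  Edge : X → X → Set
  Edge x y = IsCell x × IsCell y × (f y ≡ x)

  data Path : X → X → ℕ → Set where
    here : ∀ {x} → Path x x 0
    step : ∀ {x y z m} → Edge x y → Path y z m → Path x z (suc m)

  Reach : X → X → Set
  Reach x y = ∃ λ m → Path x y m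

  SC : X → X → Set
  SC x y = Reach x y × Reach y x

  data Conn : X → X → Set where
    conn-refl : ∀ {x} → Conn x x
    conn-fwd  : ∀ {x y z} → Edge x y → Conn y z → Conn x z
    conn-bwd  : ∀ {x y z} → Edge y x → Conn y z → Conn x z

  InSource : X → Set
  InSource r = IsCell r × (∀ y → IsCell y → SC r y → ∀ x → Edge x y → SC r x)

  Dist : X → X → ℕ → Set
  Dist r c m = Path r c m × (∀ m' → Path r c m' → m ≤ m')

  -- min over r in the ring of c's component of |(r,c)| equals m
  -- (the ring of c's component = cells in a source connected to c)
  MinRingDist : X → ℕ → Set
  MinRingDist c m =
    (Σ X λ r → InSource r × Conn r c × Dist r c m)
    × (∀ r m' → InSource r → Conn r c → Dist r c m' → m ≤ m')

  -- depth(M) = d : max over all cells c (hence max over components j of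
  -- depth^j) of MinRingDist c
  Depth : ℕ → Set
  Depth d =
    (Σ X λ c → IsCell c × MinRingDist c d)
    × (∀ c m → IsCell c → MinRingDist c m → m ≤ d)

netᵢ : ∀ {n k} → (Fin k → Fin n → Fin n) → Fin k → FunNet
netᵢ {n} σ i = record { X = Fin n ; IsCell = λ _ → ⊤ ; f = σ i }

-- maps C → C represented by their tables
Map : ℕ → Set
Map n = Vec (Fin n) n

-- the semigroup generated by Id_C, σ_1..σ_k under composition
data Gen {n k} (σ : Fin k → Fin n → Fin n) : Map n → Set where
  gen-id   : Gen σ (allFin n)
  gen-step : ∀ {γ} (i : Fin k) → Gen σ γ → Gen σ (map (σ i) γ)

-- the fundamental network restricted to edges of type i:
-- σ̃_i(γ) = σ_i ∘ γ
fundᵢ : ∀ {n k} → (Fin k → Fin n → Fin n) → Fin k → FunNet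
fundᵢ {n} σ i = record { X = Map n ; IsCell = Gen σ ; f = map (σ i) }

-- With a single edge type every cell c has exactly one in-neighbour f c, so a path of length m
-- from r to c means f^m c = r, and a cell lies in a source exactly when it is periodic under f.
-- Hence depth_i(M) is the least m such that f^m c is periodic for every cell c. On a finite set
-- a point is periodic iff it is fixed by f^(n!), so γ is periodic under γ ↦ σ_i ∘ γ iff every
-- value γ j is periodic under σ_i. Thus every cell γ of the fundamental network is periodic after
-- depth_i(N) steps, and the identity cell needs exactly that many.
module Submission where

open import Defs
open import Level using (Level)
open import Data.Nat using (ℕ; zero; suc; _+_; _*_; _∸_; _≤_; _<_; z≤n; s≤s; NonZero; _!)
open import Data.Nat.Properties using (+-comm; ≤-trans; ≰⇒>; 1+n≰n; n<1+n; m∸n+n≡m; m∸n≤m; m<n⇒0<n∸m; <⇒≤; _!≢0)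
open import Data.Nat.Divisibility using (_∣_; divides; ∣-trans; m∣m*n; m≤n⇒m!∣n!)
open import Data.Fin using (Fin; toℕ)
import Data.Fin as Fin
open import Data.Fin.Properties using (pigeonhole; all?; ¬∀⟶∃¬; toℕ≤pred[n]) renaming (_≟_ to _≟ᶠ_)
open import Data.Vec using (Vec; []; _∷_; map; lookup; allFin)
open import Data.Vec.Properties using (map-id; map-∘; lookup-map; lookup-allFin; ≡-dec)
open import Data.Product using (Σ; ∃; ∃₂; _×_; _,_; proj₁; proj₂)
open import Data.Unit using (tt)
open import Function using (_∘_; _⇔_; mk⇔; Equivalence)
open import Function.Construct.Symmetry using (⇔-sym)
open import Relation.Nullary using (Dec; yes; no; contradiction)
open import Relation.Nullary.Decidable using (map′)
open import Relation.Unary using (Decidable)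
open import Relation.Binary.Definitions using (DecidableEquality)
open import Relation.Binary.PropositionalEquality
  using (_≡_; _≗_; refl; sym; trans; cong; cong₂; cong-app; subst; module ≡-Reasoning)
import Function.Endo.Propositional as Endo
open module EndoPowers {a} {A : Set a} = Endo A using (_^_; ^-homo)

private
  variable
    a p : Level
    A : Set a
    x : A
    m m′ n d : ℕ

^-+ : ∀ (f : A → A) m n x → (f ^ (m + n)) x ≡ (f ^ m) ((f ^ n) x)
^-+ f m n x = cong-app (^-homo f m n) x

^-comm : ∀ (f : A → A) m n x → (f ^ m) ((f ^ n) x) ≡ (f ^ n) ((f ^ m) x)
^-comm f m n x = begin
  (f ^ m) ((f ^ n) x) ≡⟨ ^-+ f m n x ⟨
  (f ^ (m + n)) x     ≡⟨ cong (λ k → (f ^ k) x) (+-comm m n) ⟩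
  (f ^ (n + m)) x     ≡⟨ ^-+ f n m x ⟩
  (f ^ n) ((f ^ m) x) ∎
  where open ≡-Reasoning

^-fixed-* : ∀ {f : A → A} → (f ^ m) x ≡ x → ∀ t → (f ^ (t * m)) x ≡ x
^-fixed-* {m = m} {x = x} {f = f} e zero    = refl
^-fixed-* {m = m} {x = x} {f = f} e (suc t) = begin
  (f ^ (m + t * m)) x       ≡⟨ ^-+ f m (t * m) x ⟩
  (f ^ m) ((f ^ (t * m)) x) ≡⟨ cong (f ^ m) (^-fixed-* e t) ⟩
  (f ^ m) x                 ≡⟨ e ⟩
  x                         ∎
  where open ≡-Reasoning

^-fixed-∣ : ∀ {f : A → A} → (f ^ m) x ≡ x → m ∣ n → (f ^ n) x ≡ x
^-fixed-∣ e (divides t refl) = ^-fixed-* e t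

^-fixed-^ : ∀ {f : A → A} → (f ^ m) x ≡ x → ∀ t → (f ^ m) ((f ^ t) x) ≡ (f ^ t) x
^-fixed-^ {m = m} {x = x} {f = f} e t = trans (^-comm f m t x) (cong (f ^ t) e)

0<m≤n⇒m∣n! : 0 < m → m ≤ n → m ∣ n !
0<m≤n⇒m∣n! {suc m} _ m≤n = ∣-trans (m∣m*n (m !)) (m≤n⇒m!∣n! m≤n)

Periodic : (A → A) → A → Set _
Periodic f x = ∃ λ p → (f ^ suc p) x ≡ x

fixed⇒periodic : ∀ {f : A → A} m .{{_ : NonZero m}} → (f ^ m) x ≡ x → Periodic f x
fixed⇒periodic (suc p) e = p , e

periodic-^ : ∀ {f : A → A} → Periodic f x → ∀ t → Periodic f ((f ^ t) x)
periodic-^ (p , e) t = p , ^-fixed-^ {m = suc p} e t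

PeriodicAfter : (A → A) → A → ℕ → Set _
PeriodicAfter f x m = Periodic f ((f ^ m) x)

periodicAfter-mono : ∀ {f : A → A} → m ≤ m′ → PeriodicAfter f x m → PeriodicAfter f x m′
periodicAfter-mono {m = m} {m′ = m′} {x = x} {f = f} m≤m′ per =
  subst (PeriodicAfter f x) (m∸n+n≡m m≤m′)
    (subst (Periodic f) (sym (^-+ f (m′ ∸ m) m x)) (periodic-^ per (m′ ∸ m)))

Least : (ℕ → Set p) → ℕ → Set p
Least P m = P m × ∀ {m′} → P m′ → m ≤ m′

least : ∀ {P : ℕ → Set p} → Decidable P → P n → ∃ (Least P)
least P? Pn with P? 0
... | yes P0 = 0 , P0 , λ _ → z≤n
least {n = zero}  P? Pn | no ¬P0 = contradiction Pn ¬P0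
least {n = suc n} P? Pn | no ¬P0 with least (P? ∘ suc) Pn
... | m , Psm , min = suc m , Psm , λ { {zero} P0 → contradiction P0 ¬P0 ; {suc _} Pm′ → s≤s (min Pm′) }

Least-resp-⇔ : ∀ {P Q : ℕ → Set p} → (∀ {m} → P m ⇔ Q m) → Least P m → Least Q m
Least-resp-⇔ P⇔Q (Pm , min) = Equivalence.to P⇔Q Pm , λ Qm′ → min (Equivalence.from P⇔Q Qm′)

least-∀-attained : ∀ {Q : Fin (suc n) → ℕ → Set p} → (∀ x m → Dec (Q x m)) →
  (∀ {x m m′} → m ≤ m′ → Q x m → Q x m′) →
  Least (λ m → ∀ x → Q x m) d → ∃ λ x → Least (Q x) d
least-∀-attained {d = zero} Q? Q-mono (all , _) = Fin.zero , all Fin.zero , λ _ → z≤n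
least-∀-attained {n = n} {d = suc d} {Q = Q} Q? Q-mono (all , min)
  with x , ¬Qxd ← ¬∀⟶∃¬ (suc n) (λ x → Q x d) (λ x → Q? x d) (λ all-d → 1+n≰n (min all-d))
  = x , all x , λ Qxm → ≰⇒> (λ m≤d → ¬Qxd (Q-mono m≤d Qxm))

map-^ : ∀ (g : A → A) m → (map {n = n} g ^ m) ≗ map (g ^ m)
map-^ g zero    xs = sym (map-id xs)
map-^ g (suc m) xs = trans (cong (map g) (map-^ g m xs)) (sym (map-∘ g (g ^ m) xs))

lookup-^ : ∀ (g : A → A) m (xs : Vec A n) j → lookup ((map g ^ m) xs) j ≡ (g ^ m) (lookup xs j)
lookup-^ g m xs j = trans (cong (λ ys → lookup ys j) (map-^ g m xs)) (lookup-map j (g ^ m) xs)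

map-fixed : ∀ {h : A → A} (xs : Vec A n) → (∀ j → h (lookup xs j) ≡ lookup xs j) → map h xs ≡ xs
map-fixed []       _ = refl
map-fixed (x ∷ xs) e = cong₂ _∷_ (e Fin.zero) (map-fixed xs (e ∘ Fin.suc))

periodic-map⇒periodic-lookup : ∀ {g : A → A} {xs : Vec A n} →
  Periodic (map g) xs → ∀ j → Periodic g (lookup xs j)
periodic-map⇒periodic-lookup {g = g} {xs} (p , e) j =
  p , trans (sym (lookup-^ g (suc p) xs j)) (cong (λ ys → lookup ys j) e)

module FinitePeriodicity {n} (g : Fin n → Fin n) where

  orbit-repeats : ∀ y → ∃₂ λ i j → i < j × j ≤ n × (g ^ i) y ≡ (g ^ j) y
  orbit-repeats y
    with i , j , i<j , e ← pigeonhole (n<1+n n) (λ (k : Fin (suc n)) → (g ^ toℕ k) y)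
    = toℕ i , toℕ j , i<j , toℕ≤pred[n] j , e

  -- Within n steps every orbit reaches a cycle, whose length is at most n and hence divides n!.
  ^-n-fixed-by-^-n! : ∀ y → (g ^ (n !)) ((g ^ n) y) ≡ (g ^ n) y
  ^-n-fixed-by-^-n! y with i , j , i<j , j≤n , e ← orbit-repeats y = begin
    (g ^ (n !)) ((g ^ n) y)       ≡⟨ cong (g ^ (n !)) n-split ⟩
    (g ^ (n !)) ((g ^ (n ∸ i)) z) ≡⟨ ^-fixed-^ {m = n !} z-fixed (n ∸ i) ⟩
    (g ^ (n ∸ i)) z               ≡⟨ n-split ⟨
    (g ^ n) y                     ∎
    where
    open ≡-Reasoning
    z : Fin n
    z = (g ^ i) y
    n-split : (g ^ n) y ≡ (g ^ (n ∸ i)) z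
    n-split = trans (cong (λ k → (g ^ k) y) (sym (m∸n+n≡m (≤-trans (<⇒≤ i<j) j≤n)))) (^-+ g (n ∸ i) i y)
    z-cycle : (g ^ (j ∸ i)) z ≡ z
    z-cycle = trans (sym (^-+ g (j ∸ i) i y)) (trans (cong (λ k → (g ^ k) y) (m∸n+n≡m (<⇒≤ i<j))) (sym e))
    z-fixed : (g ^ (n !)) z ≡ z
    z-fixed = ^-fixed-∣ z-cycle (0<m≤n⇒m∣n! (m<n⇒0<n∸m i<j) (≤-trans (m∸n≤m j i) j≤n))

  periodic⇒^-n!-fixed : Periodic g x → (g ^ (n !)) x ≡ x
  periodic⇒^-n!-fixed {x} (p , e) = begin
    (g ^ (n !)) x                           ≡⟨ cong (g ^ (n !)) x-on-cycle ⟨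
    (g ^ (n !)) ((g ^ n) ((g ^ (p * n)) x)) ≡⟨ ^-n-fixed-by-^-n! ((g ^ (p * n)) x) ⟩
    (g ^ n) ((g ^ (p * n)) x)               ≡⟨ x-on-cycle ⟩
    x                                       ∎
    where
    open ≡-Reasoning
    x-on-cycle : (g ^ n) ((g ^ (p * n)) x) ≡ x
    x-on-cycle = trans (sym (^-+ g n (p * n) x)) (^-fixed-∣ {m = suc p} e (m∣m*n n))

  periodic? : Decidable (Periodic g)
  periodic? x = map′ (fixed⇒periodic (n !) {{n !≢0}}) periodic⇒^-n!-fixed ((g ^ (n !)) x ≟ᶠ x)

  periodicAfter-size : ∀ y → PeriodicAfter g y n
  periodicAfter-size y = fixed⇒periodic (n !) {{n !≢0}} (^-n-fixed-by-^-n! y)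

  least-∀-periodicAfter : ∃ (Least (λ m → ∀ x → PeriodicAfter g x m))
  least-∀-periodicAfter = least {n = n} (λ m → all? (λ x → periodic? ((g ^ m) x))) periodicAfter-size

  periodic-lookup⇒periodic-map : (xs : Vec (Fin n) m) →
    (∀ j → Periodic g (lookup xs j)) → Periodic (map g) xs
  periodic-lookup⇒periodic-map xs per =
    fixed⇒periodic (n !) {{n !≢0}} (trans (map-^ g (n !) xs) (map-fixed xs (periodic⇒^-n!-fixed ∘ per)))

  periodicAfter-map⇔ : (xs : Vec (Fin n) m) →
    PeriodicAfter (map g) xs d ⇔ (∀ j → PeriodicAfter g (lookup xs j) d)
  periodicAfter-map⇔ {d = d} xs = mk⇔
    (λ per j → subst (Periodic g) (lookup-^ g d xs j) (periodic-map⇒periodic-lookup per j))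
    (λ per → periodic-lookup⇒periodic-map _ (λ j → subst (Periodic g) (sym (lookup-^ g d xs j)) (per j)))

  periodicAfter-allFin⇔ : PeriodicAfter (map g) (allFin n) d ⇔ (∀ x → PeriodicAfter g x d)
  periodicAfter-allFin⇔ {d = d} = mk⇔
    (λ per x → subst P (lookup-allFin x) (to per x))
    (λ per → from (λ j → subst P (sym (lookup-allFin j)) (per j)))
    where
    open Equivalence (periodicAfter-map⇔ {d = d} (allFin n))
    P : Fin n → Set
    P y = PeriodicAfter g y d

module FunctionalNetwork (M : FunNet)
  (f-closed : ∀ {x} → FunNet.IsCell M x → FunNet.IsCell M (FunNet.f M x))
  (_≟_ : DecidableEquality (FunNet.X M)) where

  open FunNet M

  ^-cell : ∀ m {x} → IsCell x → IsCell ((f ^ m) x)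
  ^-cell zero    cx = cx
  ^-cell (suc m) cx = f-closed (^-cell m cx)

  path⇒^ : ∀ {x y m} → Path M x y m → (f ^ m) y ≡ x
  path⇒^ here                  = refl
  path⇒^ (step (_ , _ , e) p) = trans (cong f (path⇒^ p)) e

  ^-path : ∀ m {y} → IsCell y → Path M ((f ^ m) y) y m
  ^-path zero    cy = here
  ^-path (suc m) cy = step (^-cell (suc m) cy , ^-cell m cy , refl) (^-path m cy)

  ^⇒path : ∀ {x y m} → IsCell y → (f ^ m) y ≡ x → Path M x y m
  ^⇒path {m = m} cy refl = ^-path m cy

  path⇒conn : ∀ {x y m} → Path M x y m → Conn M x y
  path⇒conn here       = conn-refl
  path⇒conn (step e p) = conn-fwd e (path⇒conn p)

  inSource⇒periodic : ∀ {r} → InSource M r → Periodic f r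
  inSource⇒periodic {r} (cr , closed)
    with (m , r←fr) , _ ← closed r cr ((0 , here) , (0 , here)) (f r) (f-closed cr , cr , refl)
    = m , trans (sym (^-comm f m 1 r)) (path⇒^ r←fr)

  -- The predecessor f y of a periodic y lies on the same cycle.
  periodic⇒inSource : ∀ {r} → IsCell r → Periodic f r → InSource M r
  periodic⇒inSource {r} cr per = cr , closed
    where
    closed : ∀ y → IsCell y → SC M r y → ∀ x → Edge M x y → SC M r x
    closed y _ ((b , r←y) , (a , y←r)) x (cx , _ , fy≡x)
      with q , y-cycle ← subst (Periodic f) (path⇒^ y←r) (periodic-^ per a) =
      (b + q , ^⇒path cx r≡) , (suc a , ^⇒path cr (trans (cong f (path⇒^ y←r)) fy≡x))
      where
      open ≡-Reasoning
      r≡ : (f ^ (b + q)) x ≡ r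
      r≡ = begin
        (f ^ (b + q)) x           ≡⟨ cong (f ^ (b + q)) fy≡x ⟨
        (f ^ (b + q)) (f y)       ≡⟨ ^-+ f b q (f y) ⟩
        (f ^ b) ((f ^ q) (f y))   ≡⟨ cong (f ^ b) (^-comm f q 1 y) ⟩
        (f ^ b) ((f ^ suc q) y)   ≡⟨ cong (f ^ b) y-cycle ⟩
        (f ^ b) y                 ≡⟨ path⇒^ r←y ⟩
        r                         ∎

  periodicAfter-path : ∀ {r c m} → Periodic f r → Path M r c m → PeriodicAfter f c m
  periodicAfter-path per p = subst (Periodic f) (sym (path⇒^ p)) per

  least⇒dist : ∀ {r c m} → IsCell c → Least (λ j → (f ^ j) c ≡ r) m → Dist M r c m
  least⇒dist cc (e , min) = ^⇒path cc e , λ _ p → min (path⇒^ p)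

  least⇒minRingDist : ∀ {c m} → IsCell c → Least (PeriodicAfter f c) m → MinRingDist M c m
  least⇒minRingDist {c} {m} cc (per , min) =
      ((f ^ m) c , periodic⇒inSource (^-cell m cc) per , path⇒conn (^-path m cc)
        , ^-path m cc , λ _ p → min (periodicAfter-path per p))
    , λ _ _ src _ (p , _) → min (periodicAfter-path (inSource⇒periodic src) p)

  minRingDist⇒least : ∀ {c m} → IsCell c → MinRingDist M c m → Least (PeriodicAfter f c) m
  minRingDist⇒least {c} {m} cc ((_ , src , _ , p , _) , min) =
    periodicAfter-path (inSource⇒periodic src) p , bound
    where
    bound : ∀ {m′} → PeriodicAfter f c m′ → m ≤ m′
    bound {m′} per with j , j-least ← least {n = m′} (λ j → (f ^ j) c ≟ (f ^ m′) c) refl =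
      ≤-trans (min _ j (periodic⇒inSource (^-cell m′ cc) per) (path⇒conn (proj₁ dist)) dist)
              (proj₂ j-least refl)
      where
      dist : Dist M ((f ^ m′) c) c j
      dist = least⇒dist cc j-least

  depth-intro : ∀ {d} → (∃ λ c → IsCell c × Least (PeriodicAfter f c) d) →
    (∀ c → IsCell c → PeriodicAfter f c d) → Depth M d
  depth-intro (c , cc , l) bound =
    (c , cc , least⇒minRingDist cc l) , λ c′ _ cc′ mrd → proj₂ (minRingDist⇒least cc′ mrd) (bound c′ cc′)

mainTheorem16 : (n k : ℕ) (σ : Fin k → Fin (suc n) → Fin (suc n)) (i : Fin k) →
    Σ ℕ (λ d → Depth (netᵢ σ i) d × Depth (fundᵢ σ i) d)
mainTheorem16 n k σ i
  with d , d-least ← FinitePeriodicity.least-∀-periodicAfter (σ i)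
  = d , depth-net , depth-fund
  where
  open FinitePeriodicity (σ i)

  depth-net : Depth (netᵢ σ i) d
  depth-net with c , c-least ← least-∀-attained (λ x m → periodic? ((σ i ^ m) x)) periodicAfter-mono d-least =
    FunctionalNetwork.depth-intro (netᵢ σ i) (λ _ → tt) _≟ᶠ_ (c , tt , c-least) (λ x _ → proj₁ d-least x)

  depth-fund : Depth (fundᵢ σ i) d
  depth-fund = FunctionalNetwork.depth-intro (fundᵢ σ i) (gen-step i) (≡-dec _≟ᶠ_)
    (allFin _ , gen-id , Least-resp-⇔ (λ {m} → ⇔-sym (periodicAfter-allFin⇔ {d = m})) d-least)
    (λ γ _ → Equivalence.from (periodicAfter-map⇔ {d = d} γ) (λ j → proj₁ d-least (lookup γ j)))
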